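{- Let $G=(V,E)$ be any graph, $A\subseteq A'\subseteq V$ any subsets of vertices such that $A$ is $\alpha$-well-linked for a parameter $0<\alpha<1$. Assume moreover that the graph $H=G[A']\cup\mathrm{out}_G(A')$ contains a collection $\mathcal{P}$ of edge-disjoint paths connecting the edges in $\mathrm{out}_G(A')\setminus\mathrm{out}_G(A)$ to the vertices of $A$, such that each edge of $\mathrm{out}_G(A')\setminus\mathrm{out}_G(A)$ participates in exactly one such path. Then $A'$ is $\alpha$-well-linked.
   Context: $\mathrm{out}_G(J)=E_G(J,V\setminus J)$ is the set of edges with exactly one endpoint in $J$. $J$ is $\alpha$-well-linked if for every partition $(J_1,J_2)$ of $J$, letting $T_1=\mathrm{out}(J_1)\cap\mathrm{out}(J)$ and $T_2=\mathrm{out}(J_2)\cap\mathrm{out}(J)$, we have $|E(J_1,J_2)|\ge\alpha\min\{|T_1|,|T_2|\}$. $G[A']\cup\mathrm{out}_G(A')$ is the subgraph consisting of the induced subgraph on $A'$ together with the edges of $\mathrm{out}_G(A')$ and their endpoints.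
   Formalization: The parameter α is rational, with $0<\alpha<1$. -}

module Defs where

open import Data.Nat using (ℕ; _*_; _≤_; _<_; _⊔_; _⊓_)
open import Data.Fin using (Fin)
open import Data.Bool using (Bool; true; false; _∧_; _xor_; not)
open import Data.List using (List; []; _∷_; length; filterᵇ; allFin)
open import Data.List.Membership.Propositional using (_∈_)
open import Data.List.Relation.Unary.Unique.Propositional using (Unique)
open import Data.Product using (_×_; Σ; _,_)
open import Data.Sum using (_⊎_)
open import Relation.Binary.PropositionalEquality using (_≡_; _≢_)
open import Relation.Nullary using (¬_)

record Graph : Set where
  field
    n        : ℕ
    m        : ℕ
    src      : Fin m → Fin n
    tgt      : Fin m → Fin n
    loopless : ∀ e → src e ≢ tgt e
open Graph public

VSet : Graph → Set
VSet G = Fin (n G) → Bool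

_∋_ : ∀ {k} → (Fin k → Bool) → Fin k → Set
S ∋ v = S v ≡ true

_⊆_ : ∀ {k} → (Fin k → Bool) → (Fin k → Bool) → Set
_⊆_ {k} S T = ∀ (v : Fin k) → S ∋ v → T ∋ v

count : (G : Graph) → (Fin (m G) → Bool) → ℕ
count G p = length (filterᵇ p (allFin (m G)))

out : (G : Graph) → VSet G → Fin (m G) → Bool
out G S e = S (src G e) xor S (tgt G e)

between : (G : Graph) → VSet G → VSet G → Fin (m G) → Bool
between G S₁ S₂ e =
  (S₁ (src G e) ∧ S₂ (tgt G e)) Data.Bool.∨ (S₂ (src G e) ∧ S₁ (tgt G e))

-- J is α-well-linked with α = p / q: for every partition (J₁, J₂) of J
-- (J₁ ⊆ J arbitrary, J₂ = J ∖ J₁), with Tᵢ = out(Jᵢ) ∩ out(J),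
--   |E(J₁,J₂)| ≥ α · min(|T₁|,|T₂|),  i.e.  p · min(|T₁|,|T₂|) ≤ q · |E(J₁,J₂)|.
WellLinked : (G : Graph) → (p q : ℕ) → VSet G → Set
WellLinked G p q J =
  ∀ (J₁ : VSet G) → J₁ ⊆ J →
  let J₂ : VSet G
      J₂ v = J v ∧ not (J₁ v)
      T₁ = count G (λ e → out G J₁ e ∧ out G J e)
      T₂ = count G (λ e → out G J₂ e ∧ out G J e)
  in p * (T₁ ⊓ T₂) ≤ q * count G (between G J₁ J₂)

Joins : (G : Graph) → Fin (m G) → Fin (n G) → Fin (n G) → Set
Joins G e u x = (src G e ≡ u × tgt G e ≡ x) ⊎ (tgt G e ≡ u × src G e ≡ x)

data Walk (G : Graph) : Fin (n G) → Fin (n G) → Set where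
  [] : ∀ {u} → Walk G u u
  step : ∀ {u x w} (e : Fin (m G)) → Joins G e u x → Walk G x w → Walk G u w

walkEdges : ∀ {G u w} → Walk G u w → List (Fin (m G))
walkEdges [] = []
walkEdges (step e _ W) = e ∷ walkEdges W

walkVerts : ∀ {G u w} → Walk G u w → List (Fin (n G))
walkVerts {u = u} [] = u ∷ []
walkVerts {u = u} (step e _ W) = u ∷ walkVerts W

IsPath : ∀ {G u w} → Walk G u w → Set
IsPath W = Unique (walkVerts W)

InH : (G : Graph) → VSet G → Fin (m G) → Set
InH G A' e = (A' ∋ src G e × A' ∋ tgt G e) ⊎ out G A' e ≡ true

record ConnPath (G : Graph) (A A' : VSet G) (e : Fin (m G)) : Set where
  field
    start  : Fin (n G)
    end    : Fin (n G)
    walk   : Walk G start end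
    path   : IsPath walk
    first  : Σ (Fin (n G)) λ x → Σ (Joins G e start x) λ j →
               Σ (Walk G x end) λ W → walk ≡ step e j W
    startOutside : ¬ (A' ∋ start)
    inH    : ∀ f → f ∈ walkEdges walk → InH G A' f
    endInA : A ∋ end
open ConnPath public

Terminal : (G : Graph) → VSet G → VSet G → Fin (m G) → Set
Terminal G A A' e = out G A' e ≡ true × out G A e ≡ false

-- A collection 𝒫 of edge-disjoint paths in H, one for each edge of
-- out_G(A') ∖ out_G(A) (each such edge lies on exactly one path: its own).
PathSystem : (G : Graph) → VSet G → VSet G → Set
PathSystem G A A' =
  Σ ((e : Fin (m G)) → Terminal G A A' e → ConnPath G A A' e) λ P →
    ∀ e e' (t : Terminal G A A' e) (t' : Terminal G A A' e') → e ≢ e' →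
    ∀ f → f ∈ walkEdges (walk (P e t)) → ¬ (f ∈ walkEdges (walk (P e' t')))

-- Let (J₁, J₂) partition A' and Bᵢ = A ∩ Jᵢ. An edge of out(J₁) ∩ out(A') either lies in
-- out(B₁) ∩ out(A) already, or it is an edge of out(A') ∖ out(A); its path then enters J₁ ∖ A
-- and must leave it through an edge of E(J₁, J₂) not induced by A, because leaving A' would
-- take a second edge of out(A') ∖ out(A), which edge-disjointness forbids. Different edges are
-- matched with different edges, so |Tᵢ| ≤ |Tᵢᴬ| + d, where Tᵢᴬ = out(Bᵢ) ∩ out(A) and d counts
-- the edges of E(J₁, J₂) not induced by A. Well-linkedness of A for (B₁, B₂) and α ≤ 1 give
-- α min(|T₁|, |T₂|) ≤ |E(B₁, B₂)| + d = |E(J₁, J₂)|.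

module Submission where

open import Defs
open import Data.Nat using (ℕ; suc; _+_; _*_; _≤_; _<_; _⊓_; z≤n; s≤s)
open import Data.Nat.Properties
  using (≤-trans; <⇒≤; +-suc; +-mono-≤; +-monoʳ-≤; n≤1+n;
         *-monoʳ-≤; *-monoˡ-≤; *-distribˡ-+; ⊓-mono-≤; +-distribʳ-⊓; module ≤-Reasoning)
open import Data.Fin using (Fin; _≟_)
open import Data.Bool using (Bool; true; false; _∧_; _∨_; _xor_; not; T?)
open import Data.Bool.Properties using (¬-not; ∨-comm; ∨-zeroʳ; ∧-zeroʳ; ∧-identityʳ; xor-comm; xor-identityʳ; not-injective; T-≡)
open import Data.List using (List; []; _∷_; length; filterᵇ; allFin)
open import Data.List.Properties using (length-removeAt′)
open import Data.List.Relation.Unary.All as All using (All; []; _∷_)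
open import Data.List.Relation.Unary.Any using (here; there; index)
open import Data.List.Membership.Propositional using (_∈_; _─_)
open import Data.List.Membership.Propositional.Properties using (∈-allFin; ∈-filter⁺; ∈-filter⁻)
open import Data.List.Relation.Unary.Unique.Propositional using (Unique; []; _∷_)
open import Data.List.Relation.Unary.Unique.Propositional.Properties using (allFin⁺; filter⁺)
open import Data.Product using (Σ; ∃; ∃₂; _×_; _,_; proj₁; proj₂)
open import Data.Sum using (_⊎_; inj₁; inj₂)
open import Data.Empty using (⊥-elim)
open import Function using (_∘_)
open import Function.Bundles using (Equivalence)
open import Relation.Nullary using (yes; no)
open import Relation.Binary.PropositionalEquality using (_≡_; _≢_; refl; sym; trans; cong; cong₂; subst; subst₂)

module _ {X : Set} where

  length-filterᵇ-cong : ∀ {p q : X → Bool} → (∀ x → p x ≡ q x) → ∀ xs →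
                        length (filterᵇ p xs) ≡ length (filterᵇ q xs)
  length-filterᵇ-cong p≗q [] = refl
  length-filterᵇ-cong {q = q} p≗q (x ∷ xs) rewrite p≗q x with q x
  ... | true  = cong suc (length-filterᵇ-cong p≗q xs)
  ... | false = length-filterᵇ-cong p≗q xs

  length-filterᵇ-split : ∀ (p r : X → Bool) xs →
    length (filterᵇ p xs) ≡
    length (filterᵇ (λ x → p x ∧ r x) xs) + length (filterᵇ (λ x → p x ∧ not (r x)) xs)
  length-filterᵇ-split p r [] = refl
  length-filterᵇ-split p r (x ∷ xs) with p x | r x
  ... | true  | true  = cong suc (length-filterᵇ-split p r xs)
  ... | true  | false = trans (cong suc (length-filterᵇ-split p r xs)) (sym (+-suc _ _))
  ... | false | _     = length-filterᵇ-split p r xs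

  length-filterᵇ-∨ : ∀ (p q : X → Bool) xs →
    length (filterᵇ (λ x → p x ∨ q x) xs) ≤ length (filterᵇ p xs) + length (filterᵇ q xs)
  length-filterᵇ-∨ p q [] = z≤n
  length-filterᵇ-∨ p q (x ∷ xs) with p x | q x
  ... | true  | false = s≤s (length-filterᵇ-∨ p q xs)
  ... | true  | true  = s≤s (≤-trans (length-filterᵇ-∨ p q xs) (+-monoʳ-≤ _ (n≤1+n _)))
  ... | false | true  = subst (suc (length (filterᵇ (λ x → p x ∨ q x) xs)) ≤_) (sym (+-suc _ _))
                          (s≤s (length-filterᵇ-∨ p q xs))
  ... | false | false = length-filterᵇ-∨ p q xs

∈-─⁺ : ∀ {Y : Set} {y y' : Y} {ys} (y∈ys : y ∈ ys) → y' ∈ ys → y ≢ y' → y' ∈ ys ─ y∈ys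
∈-─⁺ (here refl)  (here refl)   y≢y' = ⊥-elim (y≢y' refl)
∈-─⁺ (here _)     (there y'∈ys) _    = y'∈ys
∈-─⁺ (there _)    (here refl)   _    = here refl
∈-─⁺ (there y∈ys) (there y'∈ys) y≢y' = there (∈-─⁺ y∈ys y'∈ys y≢y')

module _ {X Y : Set} (R : X → Y → Set) where

  Matched : List Y → X → Set
  Matched ys x = ∃ λ y → y ∈ ys × R x y

  length-≤-matching : (∀ {x x' y} → R x y → R x' y → x ≡ x') →
                      ∀ {xs ys} → Unique xs → All (Matched ys) xs → length xs ≤ length ys
  length-≤-matching R-injective [] [] = z≤n
  length-≤-matching R-injective {x ∷ xs} {ys} (x∉xs ∷ xs!) ((y , y∈ys , xRy) ∷ matched) =
    subst (suc (length xs) ≤_) (sym (length-removeAt′ ys (index y∈ys)))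
      (s≤s (length-≤-matching R-injective xs! (All.zipWith rematch (x∉xs , matched))))
    where
    rematch : ∀ {x'} → x ≢ x' × Matched ys x' → Matched (ys ─ y∈ys) x'
    rematch (x≢x' , y' , y'∈ys , x'Ry') =
      y' , ∈-─⁺ y∈ys y'∈ys (λ { refl → x≢x' (R-injective xRy x'Ry') }) , x'Ry'

count-≤-matching : ∀ {k} (P Q : Fin k → Bool) (R : Fin k → Fin k → Set) →
  (∀ {x x' y} → R x y → R x' y → x ≡ x') →
  (∀ x → P x ≡ true → ∃ λ y → Q y ≡ true × R x y) →
  length (filterᵇ P (allFin k)) ≤ length (filterᵇ Q (allFin k))
count-≤-matching {k} P Q R R-injective R-total =
  length-≤-matching R R-injective (filter⁺ (T? ∘ P) {allFin k} (allFin⁺ k)) (All.tabulate matched)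
  where
  matched : ∀ {x} → x ∈ filterᵇ P (allFin k) → Matched R (filterᵇ Q (allFin k)) x
  matched x∈ with R-total _ (Equivalence.to T-≡ (proj₂ (∈-filter⁻ (T? ∘ P) {xs = allFin k} x∈)))
  ... | y , Qy , xRy = y , ∈-filter⁺ (T? ∘ Q) (∈-allFin y) (Equivalence.from T-≡ Qy) , xRy

infixr 30 _∩_ _∖_
infix 4 _≐_

_∩_ : ∀ {k} → (Fin k → Bool) → (Fin k → Bool) → Fin k → Bool
(S ∩ T) v = S v ∧ T v

_∖_ : ∀ {k} → (Fin k → Bool) → (Fin k → Bool) → Fin k → Bool
(S ∖ T) v = S v ∧ not (T v)

_≐_ : ∀ {k} → (Fin k → Bool) → (Fin k → Bool) → Set
S ≐ T = ∀ v → S v ≡ T v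

∖-∋⁻ : ∀ {k} (S T : Fin k → Bool) {v} → (S ∖ T) ∋ v → S ∋ v × T v ≡ false
∖-∋⁻ S T {v} S∖Tv with S v | T v
... | true | false = refl , refl

∩-∋⁻ : ∀ {k} (S T : Fin k → Bool) {v} → (S ∩ T) ∋ v → S ∋ v × T ∋ v
∩-∋⁻ S T {v} S∩Tv with S v | T v
... | true | true = refl , refl

∖-∋⁺ : ∀ {k} (S T : Fin k → Bool) {v} → S ∋ v → T v ≡ false → (S ∖ T) ∋ v
∖-∋⁺ S T Sv Tv rewrite Sv | Tv = refl

∖-∌ : ∀ {k} (S T : Fin k → Bool) {v} → T ∋ v → (S ∖ T) v ≡ false
∖-∌ S T {v} Tv rewrite Tv = ∧-zeroʳ (S v)

⊆-∌ : ∀ {k} {S T : Fin k → Bool} {v} → S ⊆ T → T v ≡ false → S v ≡ false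
⊆-∌ {S = S} {v = v} S⊆T Tv with S v in Sv
... | false = refl
... | true  = trans (sym (S⊆T v Sv)) Tv

∖-∌⁻ : ∀ {k} (S T : Fin k → Bool) {v} → (S ∖ T) v ≡ false → S ∋ v → T ∋ v
∖-∌⁻ S T {v} S∖Tv Sv rewrite Sv = not-injective S∖Tv

∩-∖-absorb : ∀ {k} {A A' : Fin k → Bool} → A ⊆ A' → ∀ J → A ∩ (A' ∖ J) ≐ A ∖ (A ∩ J)
∩-∖-absorb {A = A} A⊆A' J v with A v in Av
... | false = refl
... | true rewrite A⊆A' v Av = refl

module GraphProperties {G : Graph} where

  induced : VSet G → Fin (m G) → Bool
  induced S f = S (src G f) ∧ S (tgt G f)

  joins-sym : ∀ {f u y} → Joins G f u y → Joins G f y u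
  joins-sym (inj₁ (s≡u , t≡y)) = inj₂ (t≡y , s≡u)
  joins-sym (inj₂ (t≡u , s≡y)) = inj₁ (s≡y , t≡u)

  out-joins : ∀ (S : VSet G) {f u y} → Joins G f u y → out G S f ≡ S u xor S y
  out-joins S (inj₁ (refl , refl)) = refl
  out-joins S {f} (inj₂ (refl , refl)) = xor-comm (S (src G f)) (S (tgt G f))

  out-off : ∀ (S : VSet G) {f u y} → Joins G f u y → S y ≡ false → out G S f ≡ S u
  out-off S {u = u} j Sy rewrite out-joins S j | Sy = xor-identityʳ (S u)

  out-inner : ∀ {S T : VSet G} {f u y} → S ⊆ T → Joins G f u y → T y ≡ false → out G S f ≡ S u
  out-inner {S} S⊆T j Ty = out-off S j (⊆-∌ S⊆T Ty)

  out-split : ∀ (S : VSet G) f → out G S f ≡ true → ∃₂ λ u y → Joins G f u y × S ∋ u × S y ≡ false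
  out-split S f ∂Sf with S (src G f) in Ss | S (tgt G f) in St
  out-split S f refl | true  | false = _ , _ , inj₁ (refl , refl) , Ss , St
  out-split S f refl | false | true  = _ , _ , inj₂ (refl , refl) , St , Ss

  out-inside : ∀ (S : VSet G) {f x y} → Joins G f x y → S ∋ x → S ∋ y → out G S f ≡ false
  out-inside S j Sx Sy = trans (out-joins S j) (cong₂ _xor_ Sx Sy)

  out-∩⁺ : ∀ {S T U : VSet G} {f} → S ⊆ U → T ⊆ U →
           out G U f ≡ true → out G S f ≡ true → out G T f ≡ true → out G (S ∩ T) f ≡ true
  out-∩⁺ {S} {T} {U} {f} S⊆U T⊆U ∂Uf ∂Sf ∂Tf with out-split U f ∂Uf
  ... | u , o , j , _ , Uo = trans (out-inner S∩T⊆U j Uo) (cong₂ _∧_ Su Tu)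
    where
    S∩T⊆U : S ∩ T ⊆ U
    S∩T⊆U v S∩Tv = S⊆U v (proj₁ (∩-∋⁻ S T S∩Tv))
    Su : S ∋ u
    Su = trans (sym (out-inner S⊆U j Uo)) ∂Sf
    Tu : T ∋ u
    Tu = trans (sym (out-inner T⊆U j Uo)) ∂Tf

  out-cong : ∀ {S T : VSet G} → S ≐ T → ∀ f → out G S f ≡ out G T f
  out-cong S≐T f = cong₂ _xor_ (S≐T (src G f)) (S≐T (tgt G f))

  between-joins : ∀ {S T : VSet G} {f u y} → Joins G f u y → S ∋ u → T ∋ y → between G S T f ≡ true
  between-joins (inj₁ (refl , refl)) Su Ty rewrite Su | Ty = refl
  between-joins (inj₂ (refl , refl)) Su Ty rewrite Su | Ty = ∨-zeroʳ _

  induced-∌ : ∀ (S : VSet G) {f u y} → Joins G f u y → S u ≡ false → induced S f ≡ false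
  induced-∌ S (inj₁ (refl , refl)) Su rewrite Su = refl
  induced-∌ S {f} (inj₂ (refl , refl)) Su rewrite Su = ∧-zeroʳ (S (src G f))

  between-cong : ∀ {S S' T T' : VSet G} → S ≐ S' → T ≐ T' → ∀ f → between G S T f ≡ between G S' T' f
  between-cong S≐S' T≐T' f =
    cong₂ _∨_ (cong₂ _∧_ (S≐S' (src G f)) (T≐T' (tgt G f))) (cong₂ _∧_ (T≐T' (src G f)) (S≐S' (tgt G f)))

  between-comm : ∀ (S T : VSet G) f → between G S T f ≡ between G T S f
  between-comm S T f = ∨-comm (S (src G f) ∧ T (tgt G f)) (T (src G f) ∧ S (tgt G f))

  between-∩ : ∀ (A S T : VSet G) f →
    between G (A ∩ S) (A ∩ T) f ≡ between G S T f ∧ induced A f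
  between-∩ A S T f with A (src G f) | A (tgt G f)
  ... | false | _     = sym (∧-zeroʳ _)
  ... | true  | false rewrite ∧-zeroʳ (S (src G f)) | ∧-zeroʳ (T (src G f)) = sym (∧-zeroʳ _)
  ... | true  | true  = sym (∧-identityʳ _)

  count-cong : ∀ {P Q : Fin (m G) → Bool} → (∀ f → P f ≡ Q f) → count G P ≡ count G Q
  count-cong P≗Q = length-filterᵇ-cong P≗Q (allFin (m G))

  count-between-split : ∀ (A S T : VSet G) →
    count G (between G S T) ≡
    count G (between G (A ∩ S) (A ∩ T)) + count G (λ f → between G S T f ∧ not (induced A f))
  count-between-split A S T =
    trans (length-filterᵇ-split (between G S T) (induced A) (allFin (m G)))
          (cong (_+ count G (λ f → between G S T f ∧ not (induced A f)))
                (count-cong (λ f → sym (between-∩ A S T f))))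

  joins-opposite : ∀ (S : VSet G) {f a b c d} → Joins G f a b → Joins G f c d →
                   S ∋ a → S c ≡ false → b ≡ c
  joins-opposite S (inj₁ (refl , refl)) (inj₁ (refl , refl)) Sa Sc with () ← trans (sym Sc) Sa
  joins-opposite S (inj₁ (refl , refl)) (inj₂ (refl , refl)) Sa Sc = refl
  joins-opposite S (inj₂ (refl , refl)) (inj₁ (refl , refl)) Sa Sc = refl
  joins-opposite S (inj₂ (refl , refl)) (inj₂ (refl , refl)) Sa Sc with () ← trans (sym Sc) Sa

  head∈walkVerts : ∀ {u w} (W : Walk G u w) → u ∈ walkVerts W
  head∈walkVerts []             = here refl
  head∈walkVerts (step _ _ _)   = here refl

  record Exit (X : VSet G) {u w} (W : Walk G u w) : Set where
    field
      edge   : Fin (m G)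
      edge∈  : edge ∈ walkEdges W
      inner  : Fin (n G)
      outer  : Fin (n G)
      joins  : Joins G edge inner outer
      inner∈ : X ∋ inner
      outer∉ : X outer ≡ false
      outer∈ : outer ∈ walkVerts W

  walk-exit : ∀ (X : VSet G) {u w} (W : Walk G u w) → X ∋ u → X w ≡ false → Exit X W
  walk-exit X []                    Xu Xw with () ← trans (sym Xw) Xu
  walk-exit X (step {x = y} f j W) Xu Xw with X y in Xy
  ... | false = record { edge = f ; edge∈ = here refl ; joins = j ; inner∈ = Xu ; outer∉ = Xy
                       ; outer∈ = there (head∈walkVerts W) }
  ... | true  = record { edge = edge ; edge∈ = there edge∈ ; joins = joins ; inner∈ = inner∈
                       ; outer∉ = outer∉ ; outer∈ = there outer∈ }
    where open Exit (walk-exit X W Xy Xw)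

module _ {G : Graph} {A A' : VSet G} where

  first-edge∈ : ∀ {e} (C : ConnPath G A A' e) → e ∈ walkEdges (walk C)
  first-edge∈ record { first = _ , _ , _ , refl } = here refl

  terminal-edge-unique : (𝒫 : PathSystem G A A') → ∀ {e f} (t : Terminal G A A' e) →
    f ∈ walkEdges (walk (proj₁ 𝒫 e t)) → Terminal G A A' f → f ≡ e
  terminal-edge-unique (P , disjoint) {e} {f} t f∈ tf with e ≟ f
  ... | yes e≡f = sym e≡f
  ... | no  e≢f = ⊥-elim (disjoint e f t tf e≢f f f∈ (first-edge∈ (P f tf)))

module Rerouting {G : Graph} {A A' : VSet G} (A⊆A' : A ⊆ A') (𝒫 : PathSystem G A A')
                 (K L : VSet G) (K⊆A' : K ⊆ A') (A'∖K⊆L : ∀ v → A' ∋ v → K v ≡ false → L ∋ v) where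

  open GraphProperties {G}

  Crossing : Fin (m G) → Bool
  Crossing f = between G K L f ∧ not (induced A f)

  Target : Fin (m G) → Bool
  Target f = (out G (A ∩ K) f ∧ out G A f) ∨ Crossing f

  Reroutes : Fin (m G) → Fin (m G) → Set
  Reroutes e f = (e ≡ f × out G A' f ≡ true)
               ⊎ Σ (Terminal G A A' e) λ t → f ∈ walkEdges (walk (proj₁ 𝒫 e t)) × out G A' f ≡ false

  exit-target : ∀ {f x y} → Joins G f x y → K ∋ x → A x ≡ false → (K ∖ A) y ≡ false → A' ∋ y →
               Target f ≡ true
  exit-target {f} {x} {y} j Kx Ax Xy A'y with K y in Ky
  ... | false = trans (cong ((out G (A ∩ K) f ∧ out G A f) ∨_) crossing) (∨-zeroʳ _)
    where
    crossing : Crossing f ≡ true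
    crossing = cong₂ _∧_ (between-joins {K} {L} j Kx (A'∖K⊆L y A'y Ky)) (cong not (induced-∌ A j Ax))
  ... | true  = cong (_∨ Crossing f) (cong₂ _∧_
                  (trans (out-joins (A ∩ K) j) (cong₂ _xor_ (cong (_∧ K x) Ax) (cong₂ _∧_ Ay Ky)))
                  (trans (out-joins A j) (cong₂ _xor_ Ax Ay)))
    where
    Ay : A ∋ y
    Ay = not-injective Xy

  exit-terminal : ∀ {f x y} → Joins G f x y → K ∋ x → A x ≡ false → A' y ≡ false → Terminal G A A' f
  exit-terminal j Kx Ax A'y =
    trans (out-joins A' j) (cong₂ _xor_ (K⊆A' _ Kx) A'y) ,
    trans (out-joins A j) (cong₂ _xor_ Ax (⊆-∌ A⊆A' A'y))

  -- An exit from A' would be an edge of out(A') ∖ out(A) on the path, hence e itself, which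
  -- would bring the path back to its start s₀.
  path-exit-target : ∀ {e s₀ x₀ w} {W : Walk G x₀ w} → Joins G e s₀ x₀ → A' s₀ ≡ false →
    All (s₀ ≢_) (walkVerts W) → (∀ {f} → f ∈ walkEdges W → Terminal G A A' f → f ≡ e) →
    (ex : Exit (K ∖ A) W) → Target (Exit.edge ex) ≡ true × out G A' (Exit.edge ex) ≡ false
  path-exit-target {e} j₀ A's₀ s₀∉W only-e ex = lands (A' outer) refl
    where
    open Exit ex
    Kx : K ∋ inner
    Kx = proj₁ (∖-∋⁻ K A inner∈)
    Ax : A inner ≡ false
    Ax = proj₂ (∖-∋⁻ K A inner∈)
    lands : ∀ b → A' outer ≡ b → Target edge ≡ true × out G A' edge ≡ false
    lands true  A'y = exit-target joins Kx Ax outer∉ A'y , out-inside A' joins (K⊆A' _ Kx) A'y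
    lands false A'y = ⊥-elim (All.lookup s₀∉W outer∈ (sym (joins-opposite A' joins-e j₀ (K⊆A' _ Kx) A's₀)))
      where
      joins-e : Joins G e inner outer
      joins-e = subst (λ g → Joins G g inner outer) (only-e edge∈ (exit-terminal joins Kx Ax A'y)) joins

  reroute : ∀ {e} (C : ConnPath G A A' e) → out G K e ≡ true → out G A e ≡ false →
            (∀ {f} → f ∈ walkEdges (walk C) → Terminal G A A' f → f ≡ e) →
            ∃ λ f → f ∈ walkEdges (walk C) × Target f ≡ true × out G A' f ≡ false
  reroute record { start = s₀ ; path = s₀∉W ∷ _ ; first = x₀ , j₀ , W , refl
                 ; startOutside = s₀∉A' ; endInA = end∈A } ∂Ke ∂Ae only-e =
    edge , there edge∈ , path-exit-target j₀ A's₀ s₀∉W (only-e ∘ there) ex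
    where
    A's₀ : A' s₀ ≡ false
    A's₀ = ¬-not s₀∉A'
    Kx₀ : K ∋ x₀
    Kx₀ = trans (sym (out-off K (joins-sym j₀) (⊆-∌ K⊆A' A's₀))) ∂Ke
    Ax₀ : A x₀ ≡ false
    Ax₀ = trans (sym (out-off A (joins-sym j₀) (⊆-∌ A⊆A' A's₀))) ∂Ae
    ex : Exit (K ∖ A) W
    ex = walk-exit (K ∖ A) W (∖-∋⁺ K A Kx₀ Ax₀) (∖-∌ K A end∈A)
    open Exit ex

  leaving-matched : ∀ e → (out G K ∩ out G A') ∋ e → ∃ λ f → Target f ≡ true × Reroutes e f
  leaving-matched e ∂K∩∂A'e = by-∂A (out G A e) refl
    where
    ∂Ke : out G K e ≡ true
    ∂Ke = proj₁ (∩-∋⁻ (out G K) (out G A') ∂K∩∂A'e)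
    ∂A'e : out G A' e ≡ true
    ∂A'e = proj₂ (∩-∋⁻ (out G K) (out G A') ∂K∩∂A'e)
    by-∂A : ∀ b → out G A e ≡ b → ∃ λ f → Target f ≡ true × Reroutes e f
    by-∂A true ∂Ae = e , cong (_∨ Crossing e) (cong₂ _∧_ (out-∩⁺ A⊆A' K⊆A' ∂A'e ∂Ae ∂Ke) ∂Ae) , inj₁ (refl , ∂A'e)
    by-∂A false ∂Ae =
      let t = ∂A'e , ∂Ae
          f , f∈ , Target-f , ∂A'f = reroute (proj₁ 𝒫 e t) ∂Ke ∂Ae (terminal-edge-unique 𝒫 t)
      in f , Target-f , inj₂ (t , f∈ , ∂A'f)

  reroutes-injective : ∀ {e e' f} → Reroutes e f → Reroutes e' f → e ≡ e'
  reroutes-injective (inj₁ (refl , _)) (inj₁ (refl , _)) = refl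
  reroutes-injective (inj₁ (_ , ∂A'f)) (inj₂ (_ , _ , ∂A'f')) with () ← trans (sym ∂A'f) ∂A'f'
  reroutes-injective (inj₂ (_ , _ , ∂A'f)) (inj₁ (_ , ∂A'f')) with () ← trans (sym ∂A'f) ∂A'f'
  reroutes-injective {e} {e'} {f} (inj₂ (t , f∈ , _)) (inj₂ (t' , f∈' , _)) with e ≟ e'
  ... | yes e≡e' = e≡e'
  ... | no  e≢e' = ⊥-elim (proj₂ 𝒫 e e' t t' e≢e' f f∈ f∈')

  leaving-≤ : count G (out G K ∩ out G A') ≤ count G (out G (A ∩ K) ∩ out G A) + count G Crossing
  leaving-≤ = ≤-trans (count-≤-matching _ Target Reroutes reroutes-injective leaving-matched)
                      (length-filterᵇ-∨ (out G (A ∩ K) ∩ out G A) Crossing (allFin (m G)))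

scaled-min-≤ : ∀ {p q t₁ t₂ a₁ a₂ c d} → p ≤ q → t₁ ≤ a₁ + d → t₂ ≤ a₂ + d →
               p * (a₁ ⊓ a₂) ≤ q * c → p * (t₁ ⊓ t₂) ≤ q * (c + d)
scaled-min-≤ {p} {q} {t₁} {t₂} {a₁} {a₂} {c} {d} p≤q t₁≤ t₂≤ a≤ = begin
  p * (t₁ ⊓ t₂)             ≤⟨ *-monoʳ-≤ p (⊓-mono-≤ t₁≤ t₂≤) ⟩
  p * ((a₁ + d) ⊓ (a₂ + d)) ≡⟨ cong (p *_) (sym (+-distribʳ-⊓ d a₁ a₂)) ⟩
  p * (a₁ ⊓ a₂ + d)         ≡⟨ *-distribˡ-+ p (a₁ ⊓ a₂) d ⟩
  p * (a₁ ⊓ a₂) + p * d     ≤⟨ +-mono-≤ a≤ (*-monoˡ-≤ d p≤q) ⟩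
  q * c + q * d             ≡⟨ sym (*-distribˡ-+ q c d) ⟩
  q * (c + d)               ∎
  where open ≤-Reasoning

claimF1 : (G : Graph) (A A' : VSet G) (p q : ℕ) →
          0 < p → p < q →
          A ⊆ A' → WellLinked G p q A → PathSystem G A A' →
          WellLinked G p q A'
claimF1 G A A' p q _ p<q A⊆A' A-wl 𝒫 J₁ J₁⊆A' = begin
  p * (count G (out G J₁ ∩ out G A') ⊓ count G (out G J₂ ∩ out G A'))
    ≤⟨ scaled-min-≤ (<⇒≤ p<q) R₁.leaving-≤ leaving₂-≤ (A-wl B₁ (λ v → proj₁ ∘ ∩-∋⁻ A J₁)) ⟩
  q * (count G (between G B₁ B₂) + count G R₁.Crossing)
    ≡⟨ cong (q *_) (sym crossing-split) ⟩
  q * count G (between G J₁ J₂) ∎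
  where
  open ≤-Reasoning
  open GraphProperties {G}
  J₂ B₁ B₂ : VSet G
  J₂ = A' ∖ J₁
  B₁ = A ∩ J₁
  B₂ = A ∖ B₁
  A∩J₂≐B₂ : A ∩ J₂ ≐ B₂
  A∩J₂≐B₂ = ∩-∖-absorb A⊆A' J₁
  module R₁ = Rerouting A⊆A' 𝒫 J₁ J₂ J₁⊆A' (λ v → ∖-∋⁺ A' J₁)
  module R₂ = Rerouting A⊆A' 𝒫 J₂ J₁ (λ v → proj₁ ∘ ∖-∋⁻ A' J₁) (λ v A'v J₂v → ∖-∌⁻ A' J₁ J₂v A'v)
  leaving₂-≤ : count G (out G J₂ ∩ out G A') ≤ count G (out G B₂ ∩ out G A) + count G R₁.Crossing
  leaving₂-≤ = subst₂ (λ a d → count G (out G J₂ ∩ out G A') ≤ a + d)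
    (count-cong (λ f → cong (_∧ out G A f) (out-cong A∩J₂≐B₂ f)))
    (count-cong (λ f → cong (_∧ _) (between-comm J₂ J₁ f)))
    R₂.leaving-≤
  crossing-split : count G (between G J₁ J₂) ≡ count G (between G B₁ B₂) + count G R₁.Crossing
  crossing-split = trans (count-between-split A J₁ J₂)
    (cong (_+ count G R₁.Crossing) (count-cong (between-cong {S = B₁} (λ _ → refl) A∩J₂≐B₂)))
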